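{- Let $S$ be a term equation system over a ranked alphabet $\Sigma$, let $p,q\in T_\Sigma$, and let $W_i,P_i,Q_i$ ($i\ge1$) be the ground term equation systems defined in the context. Then for each $i\ge1$, $P_i\cup Q_i\subseteq\Leftrightarrow^*_{W_i}$.
   Context: Notation. $\Sigma$ is a ranked alphabet ($\Sigma_m$: symbols of rank $m$), $T_\Sigma$ the ground terms, $X=\{x_1,x_2,\dots\}$, $X_n=\{x_1,\dots,x_n\}$, $T_\Sigma(X_n)$ terms with variables in $X_n$; $t[t_1,\dots,t_n]$ replaces each $x_j$ by $t_j$. A context is a term $u\in T_\Sigma(X_1)$ with exactly one occurrence of $x_1$; $u[s]$ replaces $x_1$ by $s$. A term equation system (TES) $S$ is a finite set of equations $l\approx r$ of terms. Each equation is written with $l\in T_\Sigma(X_{k+m})$, $r\in T_\Sigma(X_{k+\ell})$, where $x_1,\dots,x_k$ are the variables common to both sides and the remaining variables of $l$ and of $r$ occur on one side only and are instantiated independently. A GTES $E$ is a finite set of equations between ground terms; $\Leftrightarrow^*_E$ is the congruence on $T_\Sigma$ it generates. Congruence class computing tree automaton associated with a GTES $E$ and ground terms $p,q$: $T$ is the set of all subterms of $p$, $q$ and of both sides of all equations of $E$; $\Theta=\Leftrightarrow^*_E\cap(T\times T)$ with classes $[t]_\Theta$; states $A=\{[t]_\Theta:t\in T\}$ (new constants); rules $R=\{f([t_1]_\Theta,\dots,[t_m]_\Theta)\to[f(t_1,\dots,t_m)]_\Theta : f(t_1,\dots,t_m)\in T\}$; $\to^*_R$ is rewriting with $R$ on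 terms over $\Sigma\cup A$; every term over $\Sigma\cup A$ has a unique $R$-normal form. For each $a\in A$ a ground term $tree(a)\in T_\Sigma$ with $tree(a)\to^*_R a$ is fixed (computed by a fixed deterministic effective algorithm); for a term $z$ over $\Sigma\cup A$, $tree(z)$ replaces each state $a$ in $z$ by $tree(a)$. The automaton reaches $b$ starting from $c$ if $u[c]\to^*_R b$ for some context $u$ ($u=x_1$ allowed). Given a GTES $E$ and $i\ge1$, with $A_i,R_i,\Theta_i,tree_i$ its automaton (with $p,q$): $NORM_0$ is the set of $R_i$-normal forms of the constants of $\Sigma_0$; for $j=1,\dots,i$, $NORM_j$ is the smallest set containing $NORM_{j-1}$ and the $R_i$-normal forms of all $f(z_1,\dots,z_m)$ with $f\in\Sigma_m$, $m\ge1$, $z_1,\dots,z_m\in NORM_{j-1}$; $REP_i=\{tree_i(w):w\in NORM_i\}$. The extension step for $E$ and a target set $G$ of states adds to $E$: (ii) every equation $l[tree_i(a_1),\dots,tree_i(a_{k+m})]\approx r[tree_i(a_1),\dots,tree_i(a_k),v_{k+1},\dots,v_{k+\ell}]$ with $l\approx r\in S$, $a_1,\dots,a_{k+m},a\in A_i$, $v_{k+1},\dots,v_{k+\ell}\in REP_i$ such that $l[a_1,\dots,a_{k+m}]\to^*_{R_i}a$, the automaton reaches some state in $G$ starting from $a$, and the pair is not in $\Leftrightarrow^*_E$; (iii) symmetrically every equation $l[tree_i(a_1),\dots,tree_i(a_k),v_{k+1},\dots,v_{k+m}]\approx r[tree_i(a_1),\dots,tree_i(a_{k+\ell})]$ with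 $a_1,\dots,a_{k+\ell},a\in A_i$, $v_j\in REP_i$, $r[a_1,\dots,a_{k+\ell}]\to^*_{R_i}a$, reaching $G$ from $a$, and the pair not in $\Leftrightarrow^*_E$. $W_1$ consists of all equations $l[u_1,\dots,u_{k+m}]\approx r[u_1,\dots,u_k,v_{k+1},\dots,v_{k+\ell}]$ with $l[u_1,\dots,u_{k+m}]$ a subterm of $p$ or $q$ and $v_j\in\Sigma_0$, and all equations $l[u_1,\dots,u_k,v_{k+1},\dots,v_{k+m}]\approx r[u_1,\dots,u_{k+\ell}]$ with $r[u_1,\dots,u_{k+\ell}]$ a subterm of $p$ or $q$ and $v_j\in\Sigma_0$. $W_{i+1}$ is obtained by the extension step for $E=W_i$ (automaton of $W_i$ with $p,q$) and $G=\{[p]_{\Theta_i},[q]_{\Theta_i}\}$. $P_1$ is defined as $W_1$ but with subterms of $p$ only, and $P_{i+1}$ by the extension step for $E=P_i$ (automaton of $P_i$ with $p,q$) and $G=\{[p]_{\Theta_i}\}$. $Q_i$ is defined symmetrically with $q$. -}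

module Defs where

open import Data.Nat using (ℕ; zero; suc; _+_; _≤_; _∸_)
open import Data.Fin using (Fin; zero; suc; _↑ˡ_)
open import Data.Vec using (Vec; []; _∷_; lookup; _[_]≔_; take; _++_; map)
open import Data.Empty using (⊥)
open import Data.Product using (Σ; ∃; _×_; _,_; Σ-syntax; ∃-syntax)
open import Data.Sum using (_⊎_; inj₁; inj₂)
open import Data.List using (List)
open import Data.List.Membership.Propositional using (_∈_)
open import Relation.Binary.PropositionalEquality using (_≡_)
open import Relation.Binary.Construct.Closure.ReflexiveTransitive using (Star)
open import Relation.Nullary using (¬_)

record Sig : Set where
  field
    size  : ℕ
    arity : Fin size → ℕ
open Sig public

module _ (Σ' : Sig) where

  Sym : Set
  Sym = Fin (size Σ')

  rk : Sym → ℕ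
  rk = arity Σ'

  -- Terms over Σ with leaves ("variables" or states) from V.
  -- Ground terms T_Σ = Tm ⊥; T_Σ(X_n) = Tm (Fin n) (x_{j+1} = var j);
  -- terms over Σ ∪ A (A a set of states) = Tm A.
  data Tm (V : Set) : Set where
    var : V → Tm V
    app : (f : Sym) → Vec (Tm V) (rk f) → Tm V

  mutual
    subst : ∀ {V W : Set} → (V → Tm W) → Tm V → Tm W
    subst σ (var x)    = σ x
    subst σ (app f ts) = app f (substs σ ts)

    substs : ∀ {V W : Set} {n} → (V → Tm W) → Vec (Tm V) n → Vec (Tm W) n
    substs σ []       = []
    substs σ (t ∷ ts) = subst σ t ∷ substs σ ts

  mutual
    count : ∀ {V : Set} → Tm V → ℕ
    count (var x)    = 1
    count (app f ts) = counts ts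

    counts : ∀ {V : Set} {n} → Vec (Tm V) n → ℕ
    counts []       = 0
    counts (t ∷ ts) = count t + counts ts

  Gr : Set
  Gr = Tm ⊥

  embed : ∀ {V : Set} → Gr → Tm V
  embed = subst (λ ())

  inst : ∀ {n} {W : Set} → Tm (Fin n) → Vec (Tm W) n → Tm W
  inst t ts = subst (lookup ts) t

  data Subterm {V : Set} (s : Tm V) : Tm V → Set where
    here  : Subterm s s
    below : ∀ {f ts} (j : Fin (rk f)) → Subterm s (lookup ts j) → Subterm s (app f ts)

  IsConst : Gr → Set
  IsConst t = Σ[ c ∈ Sym ] Σ[ ts ∈ Vec Gr (rk c) ] (rk c ≡ 0 × t ≡ app c ts)

  GEqs : Set₁
  GEqs = Gr → Gr → Set

  data Conv (E : GEqs) : Gr → Gr → Set where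
    ax     : ∀ {s t} → E s t → Conv E s t
    refl'  : ∀ {s} → Conv E s s
    sym'   : ∀ {s t} → Conv E s t → Conv E t s
    trans' : ∀ {s t u} → Conv E s t → Conv E t u → Conv E s u
    cong'  : ∀ {f ts us} → (∀ j → Conv E (lookup ts j) (lookup us j))
           → Conv E (app f ts) (app f us)

  record Eqn : Set where
    field
      k m ℓ : ℕ
      lhs   : Tm (Fin (k + m))
      rhs   : Tm (Fin (k + ℓ))

  -- x_1..x_k occur on both sides (they are the common variables)
  WF : Eqn → Set
  WF e = ∀ (j : Fin (Eqn.k e)) →
           Subterm (var (j ↑ˡ Eqn.m e)) (Eqn.lhs e)
         × Subterm (var (j ↑ˡ Eqn.ℓ e)) (Eqn.rhs e)

  InT : GEqs → Gr → Gr → Gr → Set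
  InT E p q t = Subterm t p ⊎ Subterm t q
              ⊎ (Σ[ l ∈ Gr ] Σ[ r ∈ Gr ] (E l r × (Subterm t l ⊎ Subterm t r)))

  -- The state set A = T/Θ, given as a quotient structure
  -- (Agda has no quotient types): cls t = [t]_Θ.
  record Quot (E : GEqs) (p q : Gr) : Set₁ where
    field
      State    : Set
      cls      : (t : Gr) → InT E p q t → State
      cls-surj : (a : State) → Σ[ t ∈ Gr ] Σ[ h ∈ InT E p q t ] cls t h ≡ a
      cls-sound : ∀ s t hs ht → cls s hs ≡ cls t ht → Conv E s t
      cls-compl : ∀ s t hs ht → Conv E s t → cls s hs ≡ cls t ht

  module _ {E : GEqs} {p q : Gr} (Qt : Quot E p q) where
    open Quot Qt

    Rule : (f : Sym) → Vec State (rk f) → State → Set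
    Rule f as a = Σ[ ts ∈ Vec Gr (rk f) ] Σ[ h ∈ InT E p q (app f ts) ]
                  ((∀ j → Σ[ hj ∈ InT E p q (lookup ts j) ] cls (lookup ts j) hj ≡ lookup as j)
                  × cls (app f ts) h ≡ a)

    data Step : Tm State → Tm State → Set where
      top    : ∀ {f as a} → Rule f as a → Step (app f (map var as)) (var a)
      inside : ∀ {f ts t'} (j : Fin (rk f)) → Step (lookup ts j) t'
             → Step (app f ts) (app f (ts [ j ]≔ t'))

  record CCAut (E : GEqs) (p q : Gr) : Set₁ where
    field
      quot      : Quot E p q
    open Quot quot public
    field
      tree       : State → Gr
      tree-reach : ∀ a → Star (Step quot) (embed (tree a)) (var a)

  module _ {E : GEqs} {p q : Gr} (M : CCAut E p q) where
    open CCAut M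

    Steps : Tm State → Tm State → Set
    Steps = Star (Step quot)

    IsNF : Tm State → Tm State → Set
    IsNF z w = Steps z w × (∀ w' → ¬ Step quot w w')

    NORM : ℕ → Tm State → Set
    NORM zero w = Σ[ c ∈ Sym ] Σ[ zs ∈ Vec (Tm State) (rk c) ] (rk c ≡ 0 × IsNF (app c zs) w)
    NORM (suc j) w = NORM j w
      ⊎ (Σ[ f ∈ Sym ] Σ[ zs ∈ Vec (Tm State) (rk f) ]
          (1 ≤ rk f × (∀ x → NORM j (lookup zs x)) × IsNF (app f zs) w))

    treeT : Tm State → Gr
    treeT = subst tree

    REP : ℕ → Gr → Set
    REP i v = Σ[ w ∈ Tm State ] (NORM i w × v ≡ treeT w)

    Reaches : State → State → Set
    Reaches c b = Σ[ u ∈ Tm (Fin 1) ] (count u ≡ 1 × Steps (subst (λ _ → var c) u) (var b))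

    [p] : State
    [p] = cls p (inj₁ here)

    [q] : State
    [q] = cls q (inj₂ (inj₁ here))

  data ExtNew (S : List Eqn) (i : ℕ) {E : GEqs} {p q : Gr} (M : CCAut E p q)
              (G : CCAut.State M → Set) : Gr → Gr → Set where
    newL : ∀ {e} → e ∈ S
         → (as : Vec (CCAut.State M) (Eqn.k e + Eqn.m e)) (a : CCAut.State M)
         → (vs : Vec Gr (Eqn.ℓ e)) → (∀ j → REP M i (lookup vs j))
         → Steps M (inst (Eqn.lhs e) (map var as)) (var a)
         → (Σ[ g ∈ CCAut.State M ] (G g × Reaches M a g))
         → ¬ Conv E (inst (Eqn.lhs e) (map (CCAut.tree M) as))
                    (inst (Eqn.rhs e) (map (CCAut.tree M) (take (Eqn.k e) as) ++ vs))
         → ExtNew S i M G (inst (Eqn.lhs e) (map (CCAut.tree M) as))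
                          (inst (Eqn.rhs e) (map (CCAut.tree M) (take (Eqn.k e) as) ++ vs))
    newR : ∀ {e} → e ∈ S
         → (as : Vec (CCAut.State M) (Eqn.k e + Eqn.ℓ e)) (a : CCAut.State M)
         → (vs : Vec Gr (Eqn.m e)) → (∀ j → REP M i (lookup vs j))
         → Steps M (inst (Eqn.rhs e) (map var as)) (var a)
         → (Σ[ g ∈ CCAut.State M ] (G g × Reaches M a g))
         → ¬ Conv E (inst (Eqn.lhs e) (map (CCAut.tree M) (take (Eqn.k e) as) ++ vs))
                    (inst (Eqn.rhs e) (map (CCAut.tree M) as))
         → ExtNew S i M G (inst (Eqn.lhs e) (map (CCAut.tree M) (take (Eqn.k e) as) ++ vs))
                          (inst (Eqn.rhs e) (map (CCAut.tree M) as))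

  Ext : (S : List Eqn) (i : ℕ) (E : GEqs) {p q : Gr} (M : CCAut E p q)
        (G : CCAut.State M → Set) → GEqs
  Ext S i E M G s t = E s t ⊎ ExtNew S i M G s t

  data Base (S : List Eqn) (Tgt : Gr → Set) : Gr → Gr → Set where
    baseL : ∀ {e} → e ∈ S
          → (us : Vec Gr (Eqn.k e + Eqn.m e)) (vs : Vec Gr (Eqn.ℓ e))
          → (∀ j → IsConst (lookup vs j))
          → Tgt (inst (Eqn.lhs e) us)
          → Base S Tgt (inst (Eqn.lhs e) us) (inst (Eqn.rhs e) (take (Eqn.k e) us ++ vs))
    baseR : ∀ {e} → e ∈ S
          → (us : Vec Gr (Eqn.k e + Eqn.ℓ e)) (vs : Vec Gr (Eqn.m e))
          → (∀ j → IsConst (lookup vs j))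
          → Tgt (inst (Eqn.rhs e) us)
          → Base S Tgt (inst (Eqn.lhs e) (take (Eqn.k e) us ++ vs)) (inst (Eqn.rhs e) us)

  AutChoice : Gr → Gr → Set₁
  AutChoice p q = (E : GEqs) → CCAut E p q

  -- Seq 0 = base (index 1), Seq n = system with index n+1
  Seq : (S : List Eqn) (p q : Gr) (auto : AutChoice p q)
        (Gsel : ∀ {E} → (M : CCAut E p q) → CCAut.State M → Set)
        (base : GEqs) → ℕ → GEqs
  Seq S p q auto Gsel base zero = base
  Seq S p q auto Gsel base (suc n) =
    Ext S (suc n) (Seq S p q auto Gsel base n) (auto (Seq S p q auto Gsel base n))
        (Gsel (auto (Seq S p q auto Gsel base n)))

  W : (S : List Eqn) (p q : Gr) → AutChoice p q → ℕ → GEqs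
  W S p q auto i = Seq S p q auto (λ M a → a ≡ [p] M ⊎ a ≡ [q] M)
                     (Base S (λ t → Subterm t p ⊎ Subterm t q)) (i ∸ 1)

  P : (S : List Eqn) (p q : Gr) → AutChoice p q → ℕ → GEqs
  P S p q auto i = Seq S p q auto (λ M a → a ≡ [p] M)
                     (Base S (λ t → Subterm t p)) (i ∸ 1)

  Q : (S : List Eqn) (p q : Gr) → AutChoice p q → ℕ → GEqs
  Q S p q auto i = Seq S p q auto (λ M a → a ≡ [q] M)
                     (Base S (λ t → Subterm t q)) (i ∸ 1)

module Submission where

-- Let X be P (or Q) and write Xₙ, Wₙ for the systems with index n+1.  By
-- induction on n every equation s ≈ t of Xₙ is *justified* in Wₙ: s ↔*_{Wₙ} t,
-- and s, t are *recognised* by Wₙ (hereditarily ↔*-congruent, argument by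
-- argument, to terms of T_{Wₙ}, i.e. they run to states of its automaton N).
-- Recognisability is invariant under ↔*, so the invariant makes every term of
-- T_{Xₙ} recognised by Wₙ; this yields a map φ from the states of the automaton
-- M of Xₙ to those of N that carries rules to rules (module Simulation).  Runs,
-- normal forms (NORM, REP) and reachability therefore transfer from M to N, and
-- tree_M a ↔*_{Wₙ} tree_N (φ a).  So a new equation of X_{n+1} is congruent to
-- its image built from N, which holds in ↔*_{Wₙ} or is itself new in W_{n+1}
-- (module Extension); the target [p] (or [q]) of M goes to a target of N.
-- The case split "already derivable or not", and the existence of normal
-- forms, are classical: excluded middle is derived from the automaton choice
-- itself (module ExcludedMiddleFromAutomata).

open import Defs
open import Data.Nat using (ℕ; _≤_; zero; suc; _+_; _∸_)
open import Data.List using (List)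
open import Data.List.Relation.Unary.All using (All)
open import Data.Sum using (_⊎_; inj₁; inj₂)
open import Data.Product using (Σ; _×_; _,_; proj₁; proj₂; Σ-syntax)
open import Data.Empty using (⊥; ⊥-elim)
open import Data.Fin as Fin using (Fin; zero; suc)
open import Data.Vec using (Vec; []; _∷_; lookup; _[_]≔_; take; _++_; map; tabulate)
import Data.Vec.Properties as Vecₚ
open import Data.Vec.Relation.Binary.Pointwise.Extensional using (ext; Pointwise-≡⇒≡)
open import Relation.Binary.PropositionalEquality
  using (_≡_; refl; sym; trans; cong; cong₂) renaming (subst to transport; subst₂ to transport₂)
open import Relation.Binary.Construct.Closure.ReflexiveTransitive using (ε; _◅_)
open import Relation.Nullary using (¬_; Dec; yes; no)
open import Function using (_∘_)

-- Excluded middle, which the argument needs in two places (deciding whether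
-- a candidate equation is already derivable, and computing normal forms).
ExcludedMiddle : Set₁
ExcludedMiddle = (X : Set) → Dec X

Pointwise : ∀ {A B : Set} {n} → (A → B → Set) → Vec A n → Vec B n → Set
Pointwise R xs ys = ∀ j → R (lookup xs j) (lookup ys j)

pointwise-map : ∀ {A B C : Set} {R : B → C → Set} {f : A → B} {g : A → C}
              → (∀ x → R (f x) (g x)) → ∀ {n} (xs : Vec A n) → Pointwise R (map f xs) (map g xs)
pointwise-map fg (x ∷ xs) zero    = fg x
pointwise-map {R = R} fg (x ∷ xs) (suc j) = pointwise-map {R = R} fg xs j

pointwise-++ : ∀ {A B : Set} {R : A → B → Set} {n m} (xs : Vec A n) (ys : Vec B n)
               {us : Vec A m} {vs : Vec B m}
             → Pointwise R xs ys → Pointwise R us vs → Pointwise R (xs ++ us) (ys ++ vs)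
pointwise-++ []       []       _  uv j       = uv j
pointwise-++ (x ∷ xs) (y ∷ ys) xy uv zero    = xy zero
pointwise-++ {R = R} (x ∷ xs) (y ∷ ys) xy uv (suc j) = pointwise-++ {R = R} xs ys (xy ∘ suc) uv j

noArgument : ∀ {n} → n ≡ 0 → Fin n → ⊥
noArgument refl ()

choose : ∀ {B : Set} {n} {P : Fin n → B → Set}
       → (∀ j → Σ B (P j)) → Σ[ bs ∈ Vec B n ] (∀ j → P j (lookup bs j))
choose {P = P} h =
  tabulate (proj₁ ∘ h) , λ j → transport (P j) (sym (Vecₚ.lookup∘tabulate (proj₁ ∘ h) j)) (proj₂ (h j))

allOrWitness : ∀ {X : Set} {n} {Y : Fin n → Set} → (∀ j → Y j ⊎ X) → (∀ j → Y j) ⊎ X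
allOrWitness {n = zero}  h = inj₁ λ ()
allOrWitness {n = suc n} h with h zero | allOrWitness (h ∘ suc)
... | inj₂ x | _       = inj₂ x
... | inj₁ _ | inj₂ x  = inj₂ x
... | inj₁ y | inj₁ ys = inj₁ λ { zero → y ; (suc j) → ys j }

module Terms (Σ' : Sig) where

  lookup-substs : ∀ {V W : Set} {n} (σ : V → Tm Σ' W) (ts : Vec (Tm Σ' V) n) (j : Fin n)
                → lookup (substs Σ' σ ts) j ≡ subst Σ' σ (lookup ts j)
  lookup-substs σ (t ∷ ts) zero    = refl
  lookup-substs σ (t ∷ ts) (suc j) = lookup-substs σ ts j

  substs-vars : ∀ {V W : Set} {n} (σ : V → Tm Σ' W) (as : Vec V n)
              → substs Σ' σ (map var as) ≡ map σ as
  substs-vars σ []       = refl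
  substs-vars σ (a ∷ as) = cong (σ a ∷_) (substs-vars σ as)

  substs-update : ∀ {V W : Set} {n} (σ : V → Tm Σ' W) (ts : Vec (Tm Σ' V) n) j t
                → substs Σ' σ (ts [ j ]≔ t) ≡ substs Σ' σ ts [ j ]≔ subst Σ' σ t
  substs-update σ (_ ∷ ts) zero    t = refl
  substs-update σ (u ∷ ts) (suc j) t = cong (subst Σ' σ u ∷_) (substs-update σ ts j t)

  mutual
    subst-cong : ∀ {V W : Set} {σ τ : V → Tm Σ' W} → (∀ x → σ x ≡ τ x)
               → ∀ t → subst Σ' σ t ≡ subst Σ' τ t
    subst-cong h (var x)    = h x
    subst-cong h (app f ts) = cong (app f) (substs-cong h ts)

    substs-cong : ∀ {V W : Set} {σ τ : V → Tm Σ' W} → (∀ x → σ x ≡ τ x)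
                → ∀ {n} (ts : Vec (Tm Σ' V) n) → substs Σ' σ ts ≡ substs Σ' τ ts
    substs-cong h []       = refl
    substs-cong h (t ∷ ts) = cong₂ _∷_ (subst-cong h t) (substs-cong h ts)

  mutual
    subst-∘ : ∀ {U V W : Set} (σ : V → Tm Σ' W) (τ : U → Tm Σ' V) t
            → subst Σ' σ (subst Σ' τ t) ≡ subst Σ' (subst Σ' σ ∘ τ) t
    subst-∘ σ τ (var x)    = refl
    subst-∘ σ τ (app f ts) = cong (app f) (substs-∘ σ τ ts)

    substs-∘ : ∀ {U V W : Set} (σ : V → Tm Σ' W) (τ : U → Tm Σ' V) {n} (ts : Vec (Tm Σ' U) n)
             → substs Σ' σ (substs Σ' τ ts) ≡ substs Σ' (subst Σ' σ ∘ τ) ts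
    substs-∘ σ τ []       = refl
    substs-∘ σ τ (t ∷ ts) = cong₂ _∷_ (subst-∘ σ τ t) (substs-∘ σ τ ts)

  mutual
    subst-id : ∀ {V : Set} (t : Tm Σ' V) → subst Σ' var t ≡ t
    subst-id (var x)    = refl
    subst-id (app f ts) = cong (app f) (substs-id ts)

    substs-id : ∀ {V : Set} {n} (ts : Vec (Tm Σ' V) n) → substs Σ' var ts ≡ ts
    substs-id []       = refl
    substs-id (t ∷ ts) = cong₂ _∷_ (subst-id t) (substs-id ts)

  subst-embed : ∀ {V : Set} (ρ : V → Gr Σ') (g : Gr Σ') → subst Σ' ρ (embed Σ' g) ≡ g
  subst-embed ρ g = trans (subst-∘ ρ (λ ()) g) (trans (subst-cong (λ ()) g) (subst-id g))

  subst-inst-vars : ∀ {V W : Set} {n} (σ : V → Tm Σ' W) (t : Tm Σ' (Fin n)) (as : Vec V n)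
                  → subst Σ' σ (inst Σ' t (map var as)) ≡ inst Σ' t (map σ as)
  subst-inst-vars σ t as = trans (subst-∘ σ (lookup (map var as)) t) (subst-cong pointwise t)
    where
    pointwise : ∀ x → subst Σ' σ (lookup (map var as) x) ≡ lookup (map σ as) x
    pointwise x = trans (cong (subst Σ' σ) (Vecₚ.lookup-map x var as)) (sym (Vecₚ.lookup-map x σ as))

  subterm-trans : ∀ {V : Set} {a b c : Tm Σ' V} → Subterm Σ' a b → Subterm Σ' b c → Subterm Σ' a c
  subterm-trans s here        = s
  subterm-trans s (below j t) = below j (subterm-trans s t)

  mutual
    _≟_ : (s t : Gr Σ') → Dec (s ≡ t)
    var () ≟ t
    app f ts ≟ var ()
    app f ts ≟ app g us with f Fin.≟ g
    ... | no f≢g = no λ { refl → f≢g refl }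
    ... | yes refl with ts ≟s us
    ...   | yes refl  = yes refl
    ...   | no ts≢us  = no λ { refl → ts≢us refl }

    _≟s_ : ∀ {n} (ts us : Vec (Gr Σ') n) → Dec (ts ≡ us)
    []       ≟s []       = yes refl
    (t ∷ ts) ≟s (u ∷ us) with t ≟ u | ts ≟s us
    ... | yes refl | yes refl = yes refl
    ... | no t≢u   | _        = no λ { refl → t≢u refl }
    ... | yes _    | no ts≢us = no λ { refl → ts≢us refl }

module Congruence (Σ' : Sig) where
  open Terms Σ'

  conv-mono : ∀ {E F : GEqs Σ'} → (∀ {s t} → E s t → Conv Σ' F s t)
            → ∀ {s t} → Conv Σ' E s t → Conv Σ' F s t
  conv-mono h (ax e)       = h e
  conv-mono h refl'        = refl'
  conv-mono h (sym' c)     = sym' (conv-mono h c)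
  conv-mono h (trans' c d) = trans' (conv-mono h c) (conv-mono h d)
  conv-mono h (cong' cs)   = cong' (λ j → conv-mono h (cs j))

  module _ {E : GEqs Σ'} where

    conv-update : ∀ {f} (ts : Vec (Gr Σ') (rk Σ' f)) (j : Fin (rk Σ' f)) {u}
                → Conv Σ' E (lookup ts j) u → Conv Σ' E (app f ts) (app f (ts [ j ]≔ u))
    conv-update ts j {u} c = cong' componentwise
      where
      componentwise : Pointwise (Conv Σ' E) ts (ts [ j ]≔ u)
      componentwise i with i Fin.≟ j
      ... | yes refl = transport (Conv Σ' E (lookup ts i)) (sym (Vecₚ.lookup∘update i ts u)) c
      ... | no i≢j   = transport (Conv Σ' E (lookup ts i)) (sym (Vecₚ.lookup∘update′ i≢j ts u)) refl'

    mutual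
      conv-subst : ∀ {V : Set} {σ τ : V → Gr Σ'} → (∀ x → Conv Σ' E (σ x) (τ x))
                 → ∀ t → Conv Σ' E (subst Σ' σ t) (subst Σ' τ t)
      conv-subst h (var x)    = h x
      conv-subst h (app f ts) = cong' (conv-substs h ts)

      conv-substs : ∀ {V : Set} {σ τ : V → Gr Σ'} → (∀ x → Conv Σ' E (σ x) (τ x))
                  → ∀ {n} (ts : Vec (Tm Σ' V) n) → Pointwise (Conv Σ' E) (substs Σ' σ ts) (substs Σ' τ ts)
      conv-substs h (t ∷ ts) zero    = conv-subst h t
      conv-substs h (t ∷ ts) (suc j) = conv-substs h ts j

    conv-inst : ∀ {n} (t : Tm Σ' (Fin n)) (us vs : Vec (Gr Σ') n)
              → Pointwise (Conv Σ' E) us vs → Conv Σ' E (inst Σ' t us) (inst Σ' t vs)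
    conv-inst t us vs uv = conv-subst uv t

-- A ground term is recognised by the automaton of E if,
-- hereditarily, every subterm f(t₁,…,tₘ) has arguments ↔*_E-congruent to those
-- of some f(t₁',…,tₘ') ∈ T, i.e. the term runs to a state.  Unlike membership
-- in T, this is invariant under ↔*_E.
module Recognition (Σ' : Sig) (p q : Gr Σ') where
  open Terms Σ'
  open Congruence Σ'

  data Recognised (E : GEqs Σ') : Gr Σ' → Set where
    recognised : ∀ {f ts} → (∀ j → Recognised E (lookup ts j))
               → (ts' : Vec (Gr Σ') (rk Σ' f)) → InT Σ' E p q (app f ts')
               → Pointwise (Conv Σ' E) ts ts' → Recognised E (app f ts)

  InT-subterm : ∀ {E : GEqs Σ'} {a b} → Subterm Σ' a b → InT Σ' E p q b → InT Σ' E p q a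
  InT-subterm s (inj₁ sp)                           = inj₁ (subterm-trans s sp)
  InT-subterm s (inj₂ (inj₁ sq))                    = inj₂ (inj₁ (subterm-trans s sq))
  InT-subterm s (inj₂ (inj₂ (l , r , e , inj₁ sl))) = inj₂ (inj₂ (l , r , e , inj₁ (subterm-trans s sl)))
  InT-subterm s (inj₂ (inj₂ (l , r , e , inj₂ sr))) = inj₂ (inj₂ (l , r , e , inj₂ (subterm-trans s sr)))

  InT-mono : ∀ {E E' : GEqs Σ'} → (∀ {s t} → E s t → E' s t) → ∀ {a} → InT Σ' E p q a → InT Σ' E' p q a
  InT-mono h (inj₁ sp)                     = inj₁ sp
  InT-mono h (inj₂ (inj₁ sq))              = inj₂ (inj₁ sq)
  InT-mono h (inj₂ (inj₂ (l , r , e , s))) = inj₂ (inj₂ (l , r , h e , s))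

  InT-argument : ∀ {E : GEqs Σ'} {f ts} (j : Fin (rk Σ' f))
               → InT Σ' E p q (app f ts) → InT Σ' E p q (lookup ts j)
  InT-argument j = InT-subterm (below j here)

  module _ {E : GEqs Σ'} where

    mutual
      InT-recognised : ∀ t → InT Σ' E p q t → Recognised E t
      InT-recognised (var ())
      InT-recognised (app f ts) h =
        recognised (InT-recognised-args ts (λ j → InT-argument j h)) ts h (λ j → refl')

      InT-recognised-args : ∀ {n} (ts : Vec (Gr Σ') n) → (∀ j → InT Σ' E p q (lookup ts j))
                          → ∀ j → Recognised E (lookup ts j)
      InT-recognised-args (t ∷ ts) h zero    = InT-recognised t (h zero)
      InT-recognised-args (t ∷ ts) h (suc j) = InT-recognised-args ts (h ∘ suc) j

    recognised-subterm : ∀ {a b} → Subterm Σ' a b → Recognised E b → Recognised E a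
    recognised-subterm here        r                     = r
    recognised-subterm (below j s) (recognised rs _ _ _) = recognised-subterm s (rs j)

    -- Recognisability is invariant under ↔*_E (in both directions, for the sym' case).
    recognised-⇔ : ∀ {s t} → Conv Σ' E s t
                 → (Recognised E s → Recognised E t) × (Recognised E t → Recognised E s)
    recognised-⇔ (ax {s} {t} e) =
        (λ _ → InT-recognised t (inj₂ (inj₂ (s , t , e , inj₂ here))))
      , (λ _ → InT-recognised s (inj₂ (inj₂ (s , t , e , inj₁ here))))
    recognised-⇔ refl'        = (λ r → r) , (λ r → r)
    recognised-⇔ (sym' c)     = proj₂ (recognised-⇔ c) , proj₁ (recognised-⇔ c)
    recognised-⇔ (trans' c d) = proj₁ (recognised-⇔ d) ∘ proj₁ (recognised-⇔ c)
                              , proj₂ (recognised-⇔ c) ∘ proj₂ (recognised-⇔ d)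
    recognised-⇔ (cong' cs) =
        (λ { (recognised rs ts' h c) →
               recognised (λ j → proj₁ (recognised-⇔ (cs j)) (rs j)) ts' h (λ j → trans' (sym' (cs j)) (c j)) })
      , (λ { (recognised rs ts' h c) →
               recognised (λ j → proj₂ (recognised-⇔ (cs j)) (rs j)) ts' h (λ j → trans' (cs j) (c j)) })

    recognised-class : ∀ {t} → Recognised E t → Σ[ t' ∈ Gr Σ' ] (InT Σ' E p q t' × Conv Σ' E t t')
    recognised-class (recognised _ ts' h c) = app _ ts' , h , cong' c

  recognised-mono : ∀ {E E' : GEqs Σ'} → (∀ {s t} → E s t → E' s t)
                  → ∀ {a} → Recognised E a → Recognised E' a
  recognised-mono h (recognised rs ts' i c) =
    recognised (λ j → recognised-mono h (rs j)) ts' (InT-mono h i) (λ j → conv-mono (ax ∘ h) (c j))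

  -- The invariant of the main induction: s ↔*_E t, with both sides recognised by E.
  Justified : GEqs Σ' → Gr Σ' → Gr Σ' → Set
  Justified E s t = Conv Σ' E s t × Recognised E s × Recognised E t

  justify : ∀ {E s t} → Conv Σ' E s t → Recognised E s → Justified E s t
  justify c rs = c , rs , proj₁ (recognised-⇔ c) rs

  justified-sym : ∀ {E s t} → Justified E s t → Justified E t s
  justified-sym (c , rs , rt) = sym' c , rt , rs

  justified-mono : ∀ {E E' : GEqs Σ'} → (∀ {s t} → E s t → E' s t)
                 → ∀ {s t} → Justified E s t → Justified E' s t
  justified-mono h (c , rs , rt) = conv-mono (ax ∘ h) c , recognised-mono h rs , recognised-mono h rt

module Automaton (Σ' : Sig) {E : GEqs Σ'} {p q : Gr Σ'} (M : CCAut Σ' E p q) where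
  open Terms Σ'
  open Congruence Σ'
  open CCAut M

  rep : State → Gr Σ'
  rep a = proj₁ (cls-surj a)

  rep∈T : ∀ a → InT Σ' E p q (rep a)
  rep∈T a = proj₁ (proj₂ (cls-surj a))

  in-class : ∀ {t} h {a} → cls t h ≡ a → Conv Σ' E t (rep a)
  in-class {t} h {a} t∈a = cls-sound t (rep a) h (rep∈T a) (trans t∈a (sym (proj₂ (proj₂ (cls-surj a)))))

  step-sound : ∀ {z z'} → Step Σ' quot z z' → Conv Σ' E (subst Σ' rep z) (subst Σ' rep z')
  step-sound (top {f} {as} {a} (ts , h , args , root)) =
    transport (λ us → Conv Σ' E (app f us) (rep a)) (sym (substs-vars rep as))
              (trans' (cong' argument) (in-class h root))
    where
    argument : Pointwise (Conv Σ' E) (map rep as) ts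
    argument j = transport (λ u → Conv Σ' E u (lookup ts j)) (sym (Vecₚ.lookup-map j rep as))
                           (sym' (in-class (proj₁ (args j)) (proj₂ (args j))))
  step-sound (inside {f} {ts} {t'} j st) =
    transport (λ us → Conv Σ' E (app f (substs Σ' rep ts)) (app f us)) (sym (substs-update rep ts j t'))
              (conv-update (substs Σ' rep ts) j
                 (transport (λ u → Conv Σ' E u (subst Σ' rep t')) (sym (lookup-substs rep ts j)) (step-sound st)))

  steps-sound : ∀ {z z'} → Steps Σ' M z z' → Conv Σ' E (subst Σ' rep z) (subst Σ' rep z')
  steps-sound ε        = refl'
  steps-sound (s ◅ ss) = trans' (step-sound s) (steps-sound ss)

  tree-rep : ∀ a → Conv Σ' E (tree a) (rep a)
  tree-rep a = transport (λ g → Conv Σ' E g (rep a)) (subst-embed rep (tree a)) (steps-sound (tree-reach a))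

  tree-class : ∀ t h → Conv Σ' E t (tree (cls t h))
  tree-class t h = trans' (in-class h refl) (sym' (tree-rep (cls t h)))

  treeT-steps : ∀ {z z'} → Steps Σ' M z z' → Conv Σ' E (treeT Σ' M z) (treeT Σ' M z')
  treeT-steps {z} {z'} ss = trans' (to-rep z) (trans' (steps-sound ss) (sym' (to-rep z')))
    where
    to-rep : ∀ z → Conv Σ' E (treeT Σ' M z) (subst Σ' rep z)
    to-rep = conv-subst tree-rep

  run-class : ∀ {n} (t : Tm Σ' (Fin n)) (bs : Vec State n) {b}
            → Steps Σ' M (inst Σ' t (map var bs)) (var b) → Conv Σ' E (inst Σ' t (map tree bs)) (rep b)
  run-class t bs run =
    trans' (conv-inst t (map tree bs) (map rep bs) (pointwise-map {R = Conv Σ' E} tree-rep bs))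
           (transport (λ u → Conv Σ' E u _) (subst-inst-vars rep t bs) (steps-sound run))

  Normal : Tm Σ' State → Set
  Normal w = ∀ w' → ¬ Step Σ' quot w w'

  NORM-normal : ∀ j {w} → NORM Σ' M j w → Normal w
  NORM-normal zero    (_ , _ , _ , _ , nf)         = nf
  NORM-normal (suc j) (inj₁ w∈N)                   = NORM-normal j w∈N
  NORM-normal (suc j) (inj₂ (_ , _ , _ , _ , _ , nf)) = nf

  -- With normal arguments, f(z₁,…,zₘ) is either normal or rewrites in one
  -- (top) step to a state, which is normal.
  normalise-app : ExcludedMiddle → ∀ f (zs : Vec (Tm Σ' State) (rk Σ' f))
                → (∀ x → Normal (lookup zs x)) → Σ[ w ∈ Tm Σ' State ] IsNF Σ' M (app f zs) w
  normalise-app em f zs zs-normal with em (Σ[ w ∈ Tm Σ' State ] Step Σ' quot (app f zs) w)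
  ... | no irreducible  = app f zs , ε , λ w st → irreducible (w , st)
  ... | yes (w , st)    = w , st ◅ ε , target-normal st
    where
    target-normal : ∀ {w} → Step Σ' quot (app f zs) w → Normal w
    target-normal (top _)         w' ()
    target-normal (inside x st') _  _ = zs-normal x _ st'

-- Excluded middle is a consequence of the automaton choice: for a proposition
-- X, the automaton of a system whose axioms are all pairs when X holds and
-- only s₀ ≈ s₀, t₀ ≈ t₀ otherwise decides X by comparing tree [s₀] and tree [t₀],
-- since equality of ground terms is decidable (here s₀ ≢ t₀).
module ExcludedMiddleFromAutomata (Σ' : Sig) {p q : Gr Σ'} (auto : AutChoice Σ' p q)
                                  {s₀ t₀ : Gr Σ'} (s₀≢t₀ : ¬ s₀ ≡ t₀) where
  open Terms Σ'

  Probe : Set → GEqs Σ'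
  Probe X s t = X ⊎ (s ≡ s₀ × t ≡ s₀) ⊎ (s ≡ t₀ × t ≡ t₀)

  probe-conv : ∀ {X s t} → Conv Σ' (Probe X) s t → s ≡ t ⊎ X
  probe-conv (ax (inj₁ x))                    = inj₂ x
  probe-conv (ax (inj₂ (inj₁ (refl , refl)))) = inj₁ refl
  probe-conv (ax (inj₂ (inj₂ (refl , refl)))) = inj₁ refl
  probe-conv refl'                            = inj₁ refl
  probe-conv (sym' c) with probe-conv c
  ... | inj₁ s≡t = inj₁ (sym s≡t)
  ... | inj₂ x   = inj₂ x
  probe-conv (trans' c d) with probe-conv c | probe-conv d
  ... | inj₁ s≡t | inj₁ t≡u = inj₁ (trans s≡t t≡u)
  ... | inj₂ x   | _        = inj₂ x
  ... | inj₁ _   | inj₂ x   = inj₂ x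
  probe-conv (cong' cs) with allOrWitness (λ j → probe-conv (cs j))
  ... | inj₁ args-equal = inj₁ (cong (app _) (Pointwise-≡⇒≡ (ext args-equal)))
  ... | inj₂ x          = inj₂ x

  s₀∈T : ∀ {X} → InT Σ' (Probe X) p q s₀
  s₀∈T = inj₂ (inj₂ (s₀ , s₀ , inj₂ (inj₁ (refl , refl)) , inj₁ here))

  t₀∈T : ∀ {X} → InT Σ' (Probe X) p q t₀
  t₀∈T = inj₂ (inj₂ (t₀ , t₀ , inj₂ (inj₂ (refl , refl)) , inj₁ here))

  -- equal trees force s₀ ↔* t₀, hence X; X forces equal classes, hence equal trees
  decideWith : ∀ X → CCAut Σ' (Probe X) p q → Dec X
  decideWith X M with CCAut.tree M (CCAut.cls M s₀ s₀∈T) ≟ CCAut.tree M (CCAut.cls M t₀ t₀∈T)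
  ... | yes same-tree = decided (probe-conv s₀↔t₀)
    where
    open Automaton Σ' M
    s₀↔t₀ : Conv Σ' (Probe X) s₀ t₀
    s₀↔t₀ = trans' (tree-class s₀ s₀∈T)
                   (transport (λ g → Conv Σ' (Probe X) g t₀) (sym same-tree) (sym' (tree-class t₀ t₀∈T)))
    decided : s₀ ≡ t₀ ⊎ X → Dec X
    decided (inj₁ s₀≡t₀) = ⊥-elim (s₀≢t₀ s₀≡t₀)
    decided (inj₂ x)     = yes x
  ... | no different-trees =
    no λ x → different-trees (cong (CCAut.tree M) (CCAut.cls-compl M s₀ t₀ s₀∈T t₀∈T (ax (inj₁ x))))

  excludedMiddle : ExcludedMiddle
  excludedMiddle X = decideWith X (auto (Probe X))

-- Sending an E-class a to the F-class of a term of T_F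
-- congruent to it defines φ : A_M → A_N carrying rules to rules; hence runs,
-- normal forms (NORM, REP) and reachability of M carry over to N, and
-- tree_M a ↔*_F tree_N (φ a).
module Simulation (Σ' : Sig) {p q : Gr Σ'} {E F : GEqs Σ'} (M : CCAut Σ' E p q) (N : CCAut Σ' F p q)
                  (E⊆F : ∀ {s t} → E s t → Conv Σ' F s t)
                  (T-recognised : ∀ t → InT Σ' E p q t → Recognition.Recognised Σ' p q F t)
                  (em : ExcludedMiddle) where
  open Terms Σ'
  open Congruence Σ'
  open Recognition Σ' p q
  module M = CCAut M
  module N = CCAut N
  module AM = Automaton Σ' M
  module AN = Automaton Σ' N

  lift : ∀ {s t} → Conv Σ' E s t → Conv Σ' F s t
  lift = conv-mono E⊆F

  image : ∀ a → Σ[ t ∈ Gr Σ' ] (InT Σ' F p q t × Conv Σ' F (AM.rep a) t)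
  image a = recognised-class (T-recognised (AM.rep a) (AM.rep∈T a))

  φ : M.State → N.State
  φ a = N.cls (proj₁ (image a)) (proj₁ (proj₂ (image a)))

  φ-class : ∀ a t h → Conv Σ' F t (AM.rep a) → N.cls t h ≡ φ a
  φ-class a t h c = N.cls-compl t _ h _ (trans' c (proj₂ (proj₂ (image a))))

  φ-cls : ∀ t h h' → φ (M.cls t h) ≡ N.cls t h'
  φ-cls t h h' = sym (φ-class (M.cls t h) t h' (lift (AM.in-class h refl)))

  tree-φ : ∀ a → Conv Σ' F (M.tree a) (N.tree (φ a))
  tree-φ a = trans' (lift (AM.tree-rep a)) (trans' (proj₂ (proj₂ (image a))) (AN.tree-class _ _))

  trees-φ : ∀ {n} (as : Vec M.State n) → Pointwise (Conv Σ' F) (map M.tree as) (map N.tree (map φ as))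
  trees-φ as = transport (Pointwise (Conv Σ' F) (map M.tree as)) (Vecₚ.map-∘ N.tree φ as)
                         (pointwise-map {R = Conv Σ' F} tree-φ as)

  rule-φ : ∀ {f as a} → Rule Σ' M.quot f as a → Rule Σ' N.quot f (map φ as) (φ a)
  rule-φ {f} {as} {a} (ts , h , args , root) with T-recognised (app f ts) h
  ... | recognised _ ts' h' ts↔ts' =
    ts' , h' , (λ j → InT-argument j h' , argument j)
        , φ-class a (app f ts') h' (trans' (sym' (cong' ts↔ts')) (lift (AM.in-class h root)))
    where
    argument : ∀ j → N.cls (lookup ts' j) (InT-argument j h') ≡ lookup (map φ as) j
    argument j = trans (φ-class (lookup as j) (lookup ts' j) _
                          (trans' (sym' (ts↔ts' j)) (lift (AM.in-class (proj₁ (args j)) (proj₂ (args j))))))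
                       (sym (Vecₚ.lookup-map j φ as))

  rename : Tm Σ' M.State → Tm Σ' N.State
  rename = subst Σ' (var ∘ φ)

  rename-inst-vars : ∀ {n} (t : Tm Σ' (Fin n)) (as : Vec M.State n)
                   → rename (inst Σ' t (map var as)) ≡ inst Σ' t (map var (map φ as))
  rename-inst-vars t as = trans (subst-inst-vars (var ∘ φ) t as) (cong (inst Σ' t) (Vecₚ.map-∘ var φ as))

  step-φ : ∀ {z z'} → Step Σ' M.quot z z' → Step Σ' N.quot (rename z) (rename z')
  step-φ (top {f} {as} {a} r) =
    transport (λ us → Step Σ' N.quot (app f us) (var (φ a)))
              (sym (trans (substs-vars (var ∘ φ) as) (Vecₚ.map-∘ var φ as))) (top (rule-φ {as = as} r))
  step-φ (inside {f} {ts} {t'} j st) =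
    transport (λ us → Step Σ' N.quot (app f (substs Σ' (var ∘ φ) ts)) (app f us))
              (sym (substs-update (var ∘ φ) ts j t'))
              (inside j (transport (λ u → Step Σ' N.quot u (rename t'))
                                   (sym (lookup-substs (var ∘ φ) ts j)) (step-φ st)))

  steps-φ : ∀ {z z'} → Steps Σ' M z z' → Steps Σ' N (rename z) (rename z')
  steps-φ ε        = ε
  steps-φ (s ◅ ss) = step-φ s ◅ steps-φ ss

  reaches-φ : ∀ {a g} → Reaches Σ' M a g → Reaches Σ' N (φ a) (φ g)
  reaches-φ {a} {g} (u , single , run) =
    u , single , transport (λ z → Steps Σ' N z (var (φ g)))
                           (trans (subst-∘ (var ∘ φ) (λ _ → var a) u) (subst-cong (λ _ → refl) u)) (steps-φ run)

  Corresponds : Tm Σ' M.State → Tm Σ' N.State → Set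
  Corresponds z w = Conv Σ' F (treeT Σ' M z) (treeT Σ' N w)

  normalise-φ : ∀ f (zs : Vec (Tm Σ' M.State) (rk Σ' f)) (us : Vec (Tm Σ' N.State) (rk Σ' f)) {w}
              → Steps Σ' M (app f zs) w → (∀ x → AN.Normal (lookup us x)) → Pointwise Corresponds zs us
              → Σ[ w' ∈ Tm Σ' N.State ] (IsNF Σ' N (app f us) w' × Corresponds w w')
  normalise-φ f zs us run us-normal zs~us with AN.normalise-app em f us us-normal
  ... | w' , nf = w' , nf , trans' (sym' (lift (AM.treeT-steps run))) (trans' (cong' arguments) (AN.treeT-steps (proj₁ nf)))
    where
    arguments : Pointwise (Conv Σ' F) (substs Σ' M.tree zs) (substs Σ' N.tree us)
    arguments x = transport₂ (Conv Σ' F) (sym (lookup-substs M.tree zs x)) (sym (lookup-substs N.tree us x)) (zs~us x)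

  NORM-φ : ∀ j {w} → NORM Σ' M j w → Σ[ w' ∈ Tm Σ' N.State ] (NORM Σ' N j w' × Corresponds w w')
  NORM-φ zero (c , zs , nullary , run , _)
    with normalise-φ c zs (map rename zs) run (⊥-elim ∘ noArgument nullary) (⊥-elim ∘ noArgument nullary)
  ... | w' , nf , corr = w' , (c , map rename zs , nullary , nf) , corr
  NORM-φ (suc j) (inj₁ w∈N) with NORM-φ j w∈N
  ... | w' , w'∈N , corr = w' , inj₁ w'∈N , corr
  NORM-φ (suc j) (inj₂ (f , zs , nonconst , zs∈N , run , _)) with choose (λ x → NORM-φ j (zs∈N x))
  ... | us , us-ok with normalise-φ f zs us run (λ x → AN.NORM-normal j (proj₁ (us-ok x))) (proj₂ ∘ us-ok)
  ... | w' , nf , corr = w' , inj₂ (f , us , nonconst , proj₁ ∘ us-ok , nf) , corr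

  REP-φ : ∀ i {v} → REP Σ' M i v → Σ[ v' ∈ Gr Σ' ] (REP Σ' N i v' × Conv Σ' F v v')
  REP-φ i (w , w∈N , refl) with NORM-φ i w∈N
  ... | w' , w'∈N , corr = treeT Σ' N w' , (w' , w'∈N , refl) , corr

  module Extension (S : List (Eqn Σ')) (i : ℕ) (GM : M.State → Set) (GN : N.State → Set)
                   (targets : ∀ g → GM g → GN (φ g)) where

    F' : GEqs Σ'
    F' = Ext Σ' S i F N GN

    raise : ∀ {s t} → Conv Σ' F s t → Conv Σ' F' s t
    raise = conv-mono (ax ∘ inj₁)

    -- Its image
    -- under φ either holds in ↔*_F already or is, by `add`, an axiom of F'.
    new-equation : ∀ {k m ℓ} (t₁ : Tm Σ' (Fin (k + m))) (t₂ : Tm Σ' (Fin (k + ℓ))) (as : Vec M.State (k + m)) {a}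
      → (vs : Vec (Gr Σ') ℓ) → (∀ j → REP Σ' M i (lookup vs j))
      → Steps Σ' M (inst Σ' t₁ (map var as)) (var a) → Σ[ g ∈ M.State ] (GM g × Reaches Σ' M a g)
      → (∀ (vs' : Vec (Gr Σ') ℓ) → (∀ j → REP Σ' N i (lookup vs' j))
         → Steps Σ' N (inst Σ' t₁ (map var (map φ as))) (var (φ a))
         → Σ[ g ∈ N.State ] (GN g × Reaches Σ' N (φ a) g)
         → ¬ Conv Σ' F (inst Σ' t₁ (map N.tree (map φ as))) (inst Σ' t₂ (map N.tree (take k (map φ as)) ++ vs'))
         → Conv Σ' F' (inst Σ' t₁ (map N.tree (map φ as))) (inst Σ' t₂ (map N.tree (take k (map φ as)) ++ vs')))
      → Justified F' (inst Σ' t₁ (map M.tree as)) (inst Σ' t₂ (map M.tree (take k as) ++ vs))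
    new-equation {k} {m} {ℓ} t₁ t₂ as {a} vs vs-rep run (g , g-target , reach) add =
      justify (trans' (raise left) (trans' counterpart (sym' (raise right))))
              (proj₂ (recognised-⇔ (raise left)) (recognised-mono inj₁ counterpart-recognised))
      where
      bs : Vec N.State (k + m)
      bs = map φ as
      transferred : Σ[ vs' ∈ Vec (Gr Σ') ℓ ]
                      (∀ j → REP Σ' N i (lookup vs' j) × Conv Σ' F (lookup vs j) (lookup vs' j))
      transferred = choose (λ j → REP-φ i (vs-rep j))
      vs' : Vec (Gr Σ') ℓ
      vs' = proj₁ transferred
      run' : Steps Σ' N (inst Σ' t₁ (map var bs)) (var (φ a))
      run' = transport (λ z → Steps Σ' N z (var (φ a))) (rename-inst-vars t₁ as) (steps-φ run)
      A' B' : Gr Σ'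
      A' = inst Σ' t₁ (map N.tree bs)
      B' = inst Σ' t₂ (map N.tree (take k bs) ++ vs')
      counterpart : Conv Σ' F' A' B'
      counterpart with em (Conv Σ' F A' B')
      ... | yes holds = raise holds
      ... | no  fresh = add vs' (λ j → proj₁ (proj₂ transferred j)) run'
                            (φ g , targets g g-target , reaches-φ reach) fresh
      counterpart-recognised : Recognised F A'
      counterpart-recognised = proj₂ (recognised-⇔ (AN.run-class t₁ bs run')) (InT-recognised _ (AN.rep∈T (φ a)))
      left : Conv Σ' F (inst Σ' t₁ (map M.tree as)) A'
      left = conv-inst t₁ (map M.tree as) (map N.tree bs) (trees-φ as)
      shared : Pointwise (Conv Σ' F) (map M.tree (take k as)) (map N.tree (take k bs))
      shared = transport (λ cs → Pointwise (Conv Σ' F) (map M.tree (take k as)) (map N.tree cs))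
                         (sym (Vecₚ.take-map φ k as)) (trees-φ (take k as))
      right : Conv Σ' F (inst Σ' t₂ (map M.tree (take k as) ++ vs)) B'
      right = conv-inst t₂ (map M.tree (take k as) ++ vs) (map N.tree (take k bs) ++ vs')
                (pointwise-++ {R = Conv Σ' F} (map M.tree (take k as)) (map N.tree (take k bs))
                                              shared (λ j → proj₂ (proj₂ transferred j)))

    new-justified : ∀ {s t} → ExtNew Σ' S i M GM s t → Justified F' s t
    new-justified (newL {e} e∈S as a vs vs-rep run reach _) =
      new-equation (Eqn.lhs e) (Eqn.rhs e) as vs vs-rep run reach
        λ vs' vs'-rep run' reach' fresh → ax (inj₂ (newL e∈S (map φ as) (φ a) vs' vs'-rep run' reach' fresh))
    new-justified (newR {e} e∈S as a vs vs-rep run reach _) =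
      justified-sym (new-equation (Eqn.rhs e) (Eqn.lhs e) as vs vs-rep run reach
        λ vs' vs'-rep run' reach' fresh →
          sym' (ax (inj₂ (newR e∈S (map φ as) (φ a) vs' vs'-rep run' reach' (fresh ∘ sym')))))

W-target : ∀ {Σ' : Sig} {p q : Gr Σ'} {E} → (M : CCAut Σ' E p q) → CCAut.State M → Set
W-target {Σ'} M a = a ≡ [p] Σ' M ⊎ a ≡ [q] Σ' M

-- A restricted sequence (P or Q) runs against W: its base equations are
-- among W's, and its target state, the class of a fixed c ∈ T, is a target
-- state of W too.
module Restricted (Σ' : Sig) (S : List (Eqn Σ')) {p q : Gr Σ'} (auto : AutChoice Σ' p q) (em : ExcludedMiddle)
                  (Tgt : Gr Σ' → Set) (Tgt⊆ : ∀ {t} → Tgt t → Subterm Σ' t p ⊎ Subterm Σ' t q)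
                  (c : Gr Σ') (c∈T : ∀ {E} → InT Σ' E p q c)
                  (c-target : ∀ {E} (N : CCAut Σ' E p q) → W-target N (CCAut.cls N c c∈T)) where
  open Recognition Σ' p q

  Xs : ℕ → GEqs Σ'
  Xs = Seq Σ' S p q auto (λ M a → a ≡ CCAut.cls M c c∈T) (Base Σ' S Tgt)

  Ws : ℕ → GEqs Σ'
  Ws = Seq Σ' S p q auto W-target (Base Σ' S (λ t → Subterm Σ' t p ⊎ Subterm Σ' t q))

  base-in-W : ∀ {s t} → Base Σ' S Tgt s t → Base Σ' S (λ t → Subterm Σ' t p ⊎ Subterm Σ' t q) s t
  base-in-W (baseL e∈S us vs consts tgt) = baseL e∈S us vs consts (Tgt⊆ tgt)
  base-in-W (baseR e∈S us vs consts tgt) = baseR e∈S us vs consts (Tgt⊆ tgt)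

  justified : ∀ n {s t} → Xs n s t → Justified (Ws n) s t
  justified zero {s} {t} b = justify (ax w) (InT-recognised s (inj₂ (inj₂ (s , t , w , inj₁ here))))
    where
    w : Ws zero s t
    w = base-in-W b
  justified (suc n) (inj₁ old) = justified-mono inj₁ (justified n old)
  justified (suc n) (inj₂ new) = Extension.new-justified S (suc n) _ _ targets new
    where
    M : CCAut Σ' (Xs n) p q
    M = auto (Xs n)
    N : CCAut Σ' (Ws n) p q
    N = auto (Ws n)
    T-recognised : ∀ t → InT Σ' (Xs n) p q t → Recognised (Ws n) t
    T-recognised t (inj₁ sp)                          = InT-recognised t (inj₁ sp)
    T-recognised t (inj₂ (inj₁ sq))                   = InT-recognised t (inj₂ (inj₁ sq))
    T-recognised t (inj₂ (inj₂ (l , r , e , inj₁ sl))) = recognised-subterm sl (proj₁ (proj₂ (justified n e)))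
    T-recognised t (inj₂ (inj₂ (l , r , e , inj₂ sr))) = recognised-subterm sr (proj₂ (proj₂ (justified n e)))
    open Simulation Σ' M N (λ e → proj₁ (justified n e)) T-recognised em
    targets : ∀ g → g ≡ CCAut.cls M c c∈T → W-target N (φ g)
    targets g refl = transport (W-target N) (sym (φ-cls c c∈T c∈T)) (c-target N)

mainTheorem12 : (Σ' : Sig) (S : List (Eqn Σ')) → All (WF Σ') S
    → (p q : Gr Σ') (auto : AutChoice Σ' p q)
    → (i : ℕ) → 1 ≤ i
    → ∀ s t → P Σ' S p q auto i s t ⊎ Q Σ' S p q auto i s t
    → Conv Σ' (W Σ' S p q auto i) s t
-- If s = t there is
-- nothing to prove; otherwise the pair s ≢ t yields excluded middle.
mainTheorem12 Σ' S _ p q auto i _ s t s≈t with Terms._≟_ Σ' s t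
... | yes refl = refl'
... | no s≢t   = proj₁ (justified-in-W s≈t)
  where
  open Recognition Σ' p q
  em : ExcludedMiddle
  em = ExcludedMiddleFromAutomata.excludedMiddle Σ' auto s≢t
  module P-in-W = Restricted Σ' S auto em (λ t → Subterm Σ' t p) inj₁ p (inj₁ here) (λ N → inj₁ refl)
  module Q-in-W = Restricted Σ' S auto em (λ t → Subterm Σ' t q) inj₂ q (inj₂ (inj₁ here)) (λ N → inj₂ refl)
  justified-in-W : P Σ' S p q auto i s t ⊎ Q Σ' S p q auto i s t → Justified (W Σ' S p q auto i) s t
  justified-in-W (inj₁ in-P) = P-in-W.justified (i ∸ 1) in-P
  justified-in-W (inj₂ in-Q) = Q-in-W.justified (i ∸ 1) in-Q
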